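{- Let $R$ be a Boolean relation. If there is a maximality gadget for $R^*$, then there is a maximality gadget for $R$.
   Context: For a $k$-ary relation $R\subseteq\{0,1\}^k$, the zero positions of $R$ are the positions $i\in\{1,\dots,k\}$ such that every tuple in $R$ has $0$ in position $i$; $R^*$ is the relation obtained by projecting $R$ onto the remaining positions. A CSP instance with constraint language $\{R\}$ consists of a finite set $V$ of variables and constraints $R(v_1,\dots,v_k)$ with $v_j\in V$ (variables may repeat). An assignment $\sigma:V\to\{0,1\}$ is satisfying if every constraint's scope is mapped into $R$. A satisfying $\sigma$ is maximal for $v$ if $\sigma(v)=1$ or the assignment obtained from $\sigma$ by changing the value at $v$ to $1$ is not satisfying; it is locally maximal if maximal for every variable. For an instance $I$ with distinguished variable $r$: $N_0(I,r)$ is the number of locally maximal satisfying assignments with $\sigma(r)=0$; $N_1(I,r)$ is the number with $\sigma(r)=1$; $B(I,r)$ is the number of satisfying assignments that are maximal for every variable other than $r$ but not maximal for $r$. A maximality gadget for $R$ is a CSP instance $I$ with constraint language $\{R\}$ and a distinguished variable $r$ such that $N_0(I,r)=N_1(I,r)=1$ and $B(I,r)=0$. -}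

module Defs where

open import Data.Bool using (Bool; true; false; _∧_; _∨_; not; if_then_else_)
open import Data.Nat using (ℕ; zero; suc)
open import Data.Fin using (Fin; _≟_)
open import Data.List using (List; []; _∷_; _++_; length; map; allFin)
open import Data.Bool.ListAction using (all; any)
open import Data.Vec using (Vec; []; _∷_; lookup; _[_]≔_)
open import Relation.Nullary.Decidable using (⌊_⌋)
open import Relation.Binary.PropositionalEquality using (_≡_)

BRel : ℕ → Set
BRel k = Vec Bool k → Bool

allVecs : (n : ℕ) → List (Vec Bool n)
allVecs zero = [] ∷ []
allVecs (suc n) = map (false ∷_) (allVecs n) ++ map (true ∷_) (allVecs n)

count : {A : Set} → (A → Bool) → List A → ℕ
count p [] = zero
count p (x ∷ xs) = if p x then suc (count p xs) else count p xs

filterᵇ : {A : Set} → (A → Bool) → List A → List A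
filterᵇ p [] = []
filterᵇ p (x ∷ xs) = if p x then x ∷ filterᵇ p xs else filterᵇ p xs

eqBool : Bool → Bool → Bool
eqBool true b = b
eqBool false b = not b

eqVec : {n : ℕ} → Vec Bool n → Vec Bool n → Bool
eqVec [] [] = true
eqVec (a ∷ as) (b ∷ bs) = eqBool a b ∧ eqVec as bs

isZeroPos : {k : ℕ} → BRel k → Fin k → Bool
isZeroPos {k} R i = all (λ t → not (R t) ∨ not (lookup t i)) (allVecs k)

nonZeroPos : {k : ℕ} → BRel k → List (Fin k)
nonZeroPos {k} R = filterᵇ (λ i → not (isZeroPos R i)) (allFin k)

projV : {k : ℕ} → (ps : List (Fin k)) → Vec Bool k → Vec Bool (length ps)
projV [] t = []
projV (p ∷ ps) t = lookup t p ∷ projV ps t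

starArity : {k : ℕ} → BRel k → ℕ
starArity R = length (nonZeroPos R)

star : {k : ℕ} → (R : BRel k) → BRel (starArity R)
star {k} R t' = any (λ t → R t ∧ eqVec (projV (nonZeroPos R) t) t') (allVecs k)

record Instance (k : ℕ) : Set where
  field
    nvars       : ℕ
    constraints : List (Vec (Fin nvars) k)   -- scopes of the constraints R(v₁,…,v_k)

module _ {k : ℕ} (R : BRel k) (I : Instance k) where
  open Instance I

  Assignment : Set
  Assignment = Vec Bool nvars

  satisfies : Assignment → Bool
  satisfies σ = all (λ sc → R (Data.Vec.map (lookup σ) sc)) constraints

  -- σ is maximal for v (assuming σ satisfying)
  maximalFor : Assignment → Fin nvars → Bool
  maximalFor σ v = lookup σ v ∨ not (satisfies (σ [ v ]≔ true))

  locallyMaximal : Assignment → Bool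
  locallyMaximal σ = satisfies σ ∧ all (maximalFor σ) (allFin nvars)

  N₀ : Fin nvars → ℕ
  N₀ r = count (λ σ → locallyMaximal σ ∧ not (lookup σ r)) (allVecs nvars)

  N₁ : Fin nvars → ℕ
  N₁ r = count (λ σ → locallyMaximal σ ∧ lookup σ r) (allVecs nvars)

  Bcount : Fin nvars → ℕ
  Bcount r = count (λ σ → satisfies σ
                          ∧ all (λ v → ⌊ v ≟ r ⌋ ∨ maximalFor σ v) (allFin nvars)
                          ∧ not (maximalFor σ r))
                   (allVecs nvars)

record MaxGadget {k : ℕ} (R : BRel k) : Set where
  field
    inst : Instance k
    root : Fin (Instance.nvars inst)
    N₀≡1 : N₀ R inst root ≡ 1
    N₁≡1 : N₁ R inst root ≡ 1
    B≡0  : Bcount R inst root ≡ 0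

module Submission where

-- Let I′ be a gadget for R* with root r.  Build I over {R} with one fresh
-- variable 0 in front of the variables of I′: each constraint R*(s) becomes
-- R(t), where t carries s on the non-zero positions of R and the fresh
-- variable on every zero position (liftScope).  Since the tuples of R are
-- exactly the tuples of R* padded with zeros, R(pad b s) ⟺ R*(s) ∧ (b = 0 or
-- R has no zero position) (Padding.pad-correct).  Hence the fresh variable
-- does not interact with the others: it is either free or forced to 0
-- (FreshVariable.Extends).  In both cases every locally maximal assignment
-- of I is one of I′ extended by the single value c allowed by maximality at
-- the fresh variable, and the same holds for the assignments counted by B
-- (FreshVariable.fiber); counting over b ∷ σ (count-extend) then shows that
-- N₀, N₁ and B of I at root suc r agree with those of I′ at r.

open import Defs
open import Algebra.Bundles using (CommutativeMonoid)
open import Data.Bool using (Bool; true; false; T; _∧_; _∨_; not; if_then_else_)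
open import Data.Bool.ListAction using (and; all; any)
open import Data.Bool.Properties using (T-≡; T-∧; ∧-assoc; ∧-identityʳ; ∧-zeroʳ; ∧-inverseʳ; ∨-assoc; ∧-commutativeMonoid)
open import Data.Empty using (⊥; ⊥-elim)
open import Data.Fin using (Fin; zero; suc; _≟_)
open import Data.List using (List; []; _∷_; _++_; length; map; null; filter; tabulate; allFin)
open import Data.List.Properties using (map-∘; map-cong; map-tabulate)
open import Data.List.Membership.Propositional using (_∈_; _∉_; lose)
open import Data.List.Membership.Propositional.Properties using (∈-allFin; ∈-map⁺; ∈-++⁺ˡ; ∈-++⁺ʳ; ∈-filter⁺; ∈-filter⁻)
import Data.List.Relation.Unary.All as All
open import Data.List.Relation.Unary.All.Properties using (all⁺; All¬⇒¬Any)
open import Data.List.Relation.Unary.Any using (here; there; satisfied)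
open import Data.List.Relation.Unary.Any.Properties using (any⁺; any⁻)
open import Data.List.Relation.Unary.Unique.Propositional using (Unique; _∷_)
import Data.List.Relation.Unary.Unique.Propositional.Properties as Unique
open import Data.Nat using (ℕ; suc; _+_)
open import Data.Nat.Properties using (+-identityʳ)
open import Data.Product using (_,_; proj₂)
open import Data.Unit using (tt)
open import Data.Vec using (Vec; []; _∷_; lookup; replicate; _[_]≔_) renaming (map to mapᵛ)
open import Data.Vec.Properties using (lookup∘update; lookup∘update′; lookup-replicate; map-[]≔; map-replicate) renaming (map-∘ to mapᵛ-∘)
open import Data.Vec.Relation.Binary.Pointwise.Extensional using (ext; Pointwise-≡⇒≡)
open import Function using (_∘_; Equivalence)
open import Relation.Nullary using (yes; no)
open import Relation.Nullary.Decidable using (T?; ⌊_⌋)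
open import Relation.Binary.PropositionalEquality using (_≡_; refl; sym; trans; cong; cong₂; subst; module ≡-Reasoning)
open import Algebra.Properties.CommutativeSemigroup (CommutativeMonoid.commutativeSemigroup ∧-commutativeMonoid) using (xy∙z≈xz∙y)

open ≡-Reasoning

T-ext : ∀ {x y : Bool} → (T x → T y) → (T y → T x) → x ≡ y
T-ext {true}  {true}  _ _ = refl
T-ext {true}  {false} f _ = ⊥-elim (f tt)
T-ext {false} {true}  _ g = ⊥-elim (g tt)
T-ext {false} {false} _ _ = refl

nandˡ : ∀ {a b} → T (not a ∨ not b) → T a → b ≡ false
nandˡ {true} {false} _ _ = refl

nandʳ : ∀ {a b} → T (not a ∨ not b) → T b → a ≡ false
nandʳ {false} {true} _ _ = refl

-- Testing equality in Fin commutes with suc (⌊_⌋ inspects the decision, so this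
-- is not definitional).
⌊suc≟suc⌋ : ∀ {n} (v r : Fin n) → ⌊ suc v ≟ suc r ⌋ ≡ ⌊ v ≟ r ⌋
⌊suc≟suc⌋ v r with v ≟ r
... | yes _ = refl
... | no  _ = refl

vec-ext : ∀ {A : Set} {n} {u w : Vec A n} → (∀ i → lookup u i ≡ lookup w i) → u ≡ w
vec-ext h = Pointwise-≡⇒≡ (ext h)

all-cong : ∀ {A : Set} {f g : A → Bool} → (∀ x → f x ≡ g x) → ∀ xs → all f xs ≡ all g xs
all-cong f≗g xs = cong and (map-cong f≗g xs)

all-map : ∀ {A B : Set} (f : B → Bool) (g : A → B) xs → all f (map g xs) ≡ all (f ∘ g) xs
all-map f g xs = cong and (sym (map-∘ xs))

-- A conjunct that does not depend on the list element can be pulled out,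
-- except over the empty list, where the conjunction is vacuously true.
all-∧-const : ∀ {A : Set} (f : A → Bool) (q : Bool) xs →
              all (λ x → f x ∧ q) xs ≡ all f xs ∧ (q ∨ null xs)
all-∧-const f true  xs = trans (all-cong (λ x → ∧-identityʳ (f x)) xs) (sym (∧-identityʳ (all f xs)))
all-∧-const f false []       = refl
all-∧-const f false (x ∷ xs) = trans (cong (_∧ all (λ x → f x ∧ false) xs) (∧-zeroʳ (f x))) (sym (∧-zeroʳ _))

all-allFin-suc : ∀ {n} (f : Fin (suc n) → Bool) →
                 all f (allFin (suc n)) ≡ f zero ∧ all (f ∘ suc) (allFin n)
all-allFin-suc {n} f = cong (f zero ∧_) (begin
  all f (tabulate suc)          ≡⟨ cong (all f) (sym (map-tabulate (λ i → i) suc)) ⟩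
  all f (map suc (allFin n))    ≡⟨ all-map f suc (allFin n) ⟩
  all (f ∘ suc) (allFin n)      ∎)

allVecs-complete : ∀ {n} (v : Vec Bool n) → v ∈ allVecs n
allVecs-complete []          = here refl
allVecs-complete (false ∷ v) = ∈-++⁺ˡ (∈-map⁺ (false ∷_) (allVecs-complete v))
allVecs-complete {suc n} (true ∷ v) = ∈-++⁺ʳ (map (false ∷_) (allVecs n)) (∈-map⁺ (true ∷_) (allVecs-complete v))

eqVec-refl : ∀ {n} (v : Vec Bool n) → T (eqVec v v)
eqVec-refl []          = tt
eqVec-refl (true ∷ v)  = eqVec-refl v
eqVec-refl (false ∷ v) = eqVec-refl v

eqVec-sound : ∀ {n} {v w : Vec Bool n} → T (eqVec v w) → v ≡ w
eqVec-sound {v = []}        {[]}        _ = refl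
eqVec-sound {v = true ∷ v}  {true ∷ w}  e = cong (true ∷_) (eqVec-sound e)
eqVec-sound {v = false ∷ v} {false ∷ w} e = cong (false ∷_) (eqVec-sound e)

filterᵇ-filter : ∀ {A : Set} (p : A → Bool) xs → filterᵇ p xs ≡ filter (T? ∘ p) xs
filterᵇ-filter p []       = refl
filterᵇ-filter p (x ∷ xs) with p x
... | true  = cong (x ∷_) (filterᵇ-filter p xs)
... | false = filterᵇ-filter p xs

count-++ : ∀ {A : Set} (p : A → Bool) xs ys → count p (xs ++ ys) ≡ count p xs + count p ys
count-++ p []       ys = refl
count-++ p (x ∷ xs) ys with p x
... | true  = cong suc (count-++ p xs ys)
... | false = count-++ p xs ys

count-map : ∀ {A B : Set} (p : B → Bool) (g : A → B) xs → count p (map g xs) ≡ count (p ∘ g) xs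
count-map p g []       = refl
count-map p g (x ∷ xs) with p (g x)
... | true  = cong suc (count-map p g xs)
... | false = count-map p g xs

count-cong : ∀ {A : Set} {p q : A → Bool} → (∀ x → p x ≡ q x) → ∀ xs → count p xs ≡ count q xs
count-cong p≗q []       = refl
count-cong {q = q} p≗q (x ∷ xs) rewrite p≗q x with q x
... | true  = cong suc (count-cong p≗q xs)
... | false = count-cong p≗q xs

count-∧-const : ∀ {A : Set} (p : A → Bool) (b : Bool) xs →
                count (λ x → p x ∧ b) xs ≡ (if b then count p xs else 0)
count-∧-const p true  xs = count-cong (λ x → ∧-identityʳ (p x)) xs
count-∧-const p false []       = refl
count-∧-const p false (x ∷ xs) rewrite ∧-zeroʳ (p x) = count-∧-const p false xs

fill : ∀ {A : Set} {k} (qs : List (Fin k)) → Vec A (length qs) → Vec A k → Vec A k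
fill []       []       base = base
fill (q ∷ qs) (x ∷ xs) base = fill qs xs (base [ q ]≔ x)

fill-outside : ∀ {A : Set} {k} (qs : List (Fin k)) xs (base : Vec A k) {i} →
               i ∉ qs → lookup (fill qs xs base) i ≡ lookup base i
fill-outside []       []       base i∉ = refl
fill-outside (q ∷ qs) (x ∷ xs) base {i} i∉ = begin
  lookup (fill qs xs (base [ q ]≔ x)) i  ≡⟨ fill-outside qs xs (base [ q ]≔ x) (i∉ ∘ there) ⟩
  lookup (base [ q ]≔ x) i               ≡⟨ lookup∘update′ (i∉ ∘ here) base x ⟩
  lookup base i                          ∎

projV-fill : ∀ {k} (qs : List (Fin k)) → Unique qs → ∀ xs base → projV qs (fill qs xs base) ≡ xs
projV-fill []       _          []       base = refl
projV-fill (q ∷ qs) (q∉ ∷ uqs) (x ∷ xs) base = cong₂ _∷_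
  (trans (fill-outside qs xs (base [ q ]≔ x) (All¬⇒¬Any q∉)) (lookup∘update q base x))
  (projV-fill qs uqs xs (base [ q ]≔ x))

fill-projV : ∀ {k} (qs : List (Fin k)) (u base : Vec Bool k) →
             (∀ {i} → i ∉ qs → lookup u i ≡ lookup base i) → fill qs (projV qs u) base ≡ u
fill-projV []       u base agree = vec-ext (λ i → sym (agree λ ()))
fill-projV (q ∷ qs) u base agree = fill-projV qs u (base [ q ]≔ lookup u q) agree′
  where
  agree′ : ∀ {i} → i ∉ qs → lookup u i ≡ lookup (base [ q ]≔ lookup u q) i
  agree′ {i} i∉ with i ≟ q
  ... | yes refl = sym (lookup∘update i base (lookup u i))
  ... | no  i≢q  = trans (agree λ { (here i≡q) → i≢q i≡q ; (there i∈) → i∉ i∈ })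
                         (sym (lookup∘update′ i≢q base (lookup u q)))

map-fill : ∀ {A B : Set} {k} (f : A → B) (qs : List (Fin k)) xs base →
           mapᵛ f (fill qs xs base) ≡ fill qs (mapᵛ f xs) (mapᵛ f base)
map-fill f []       []       base = refl
map-fill f (q ∷ qs) (x ∷ xs) base =
  trans (map-fill f qs xs (base [ q ]≔ x)) (cong (fill qs (mapᵛ f xs)) (map-[]≔ f base q))

module ZeroPositions {k : ℕ} (R : BRel k) where

  zeroPos-vanishes : ∀ {i u} → T (isZeroPos R i) → T (R u) → lookup u i ≡ false
  zeroPos-vanishes {i} {u} zi Ru = nandˡ (All.lookup (all⁺ _ (allVecs k) zi) (allVecs-complete u)) Ru

  nonZero : Fin k → Bool
  nonZero i = not (isZeroPos R i)

  nonZeroPos-filter : nonZeroPos R ≡ filter (T? ∘ nonZero) (allFin k)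
  nonZeroPos-filter = filterᵇ-filter nonZero (allFin k)

  nonZeroPos-unique : Unique (nonZeroPos R)
  nonZeroPos-unique = subst Unique (sym nonZeroPos-filter) (Unique.filter⁺ (T? ∘ nonZero) (Unique.allFin⁺ k))

  zeroPos⇒∉ : ∀ {i} → T (isZeroPos R i) → i ∉ nonZeroPos R
  zeroPos⇒∉ {i} zi i∈ =
    T-not (proj₂ (∈-filter⁻ (T? ∘ nonZero) {xs = allFin k} (subst (i ∈_) nonZeroPos-filter i∈))) zi
    where
    T-not : ∀ {b} → T (not b) → T b → ⊥
    T-not {false} _ ()

  ∉⇒zeroPos : ∀ {i} → i ∉ nonZeroPos R → T (isZeroPos R i)
  ∉⇒zeroPos {i} i∉ with isZeroPos R i in zi
  ... | true  = tt
  ... | false = ⊥-elim (i∉ (subst (i ∈_) (sym nonZeroPos-filter)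
                              (∈-filter⁺ (T? ∘ nonZero) (∈-allFin i) (subst (T ∘ not) (sym zi) tt))))

module Padding {k : ℕ} (R : BRel k) where
  open ZeroPositions R

  hasZeroPos : Bool
  hasZeroPos = any (isZeroPos R) (allFin k)

  pad : Bool → Vec Bool (starArity R) → Vec Bool k
  pad b s = fill (nonZeroPos R) s (replicate k b)

  pad-zeroPos : ∀ b s {i} → T (isZeroPos R i) → lookup (pad b s) i ≡ b
  pad-zeroPos b s {i} zi = trans (fill-outside (nonZeroPos R) s (replicate k b) (zeroPos⇒∉ zi)) (lookup-replicate i b)

  projV-pad : ∀ b s → projV (nonZeroPos R) (pad b s) ≡ s
  projV-pad b s = projV-fill (nonZeroPos R) nonZeroPos-unique s (replicate k b)

  pad-sound : ∀ b s → T (R (pad b s)) → T (star R s ∧ (not b ∨ not hasZeroPos))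
  pad-sound b s Rpad = Equivalence.from T-∧ (R*s , nand-intro noOneAtZeroPos)
    where
    R*s : T (star R s)
    R*s = any⁺ _ (lose (allVecs-complete (pad b s))
                   (Equivalence.from T-∧ (Rpad , subst (λ v → T (eqVec v s)) (sym (projV-pad b s)) (eqVec-refl s))))
    noOneAtZeroPos : T b → T hasZeroPos → ⊥
    noOneAtZeroPos bt Z with satisfied (any⁻ _ (allFin k) Z)
    ... | i , zi = subst T (trans (sym (pad-zeroPos b s zi)) (zeroPos-vanishes zi Rpad)) bt
    nand-intro : ∀ {a b} → (T a → T b → ⊥) → T (not a ∨ not b)
    nand-intro {false}         _ = tt
    nand-intro {true} {false}  _ = tt
    nand-intro {true} {true}   h = h tt tt

  -- Conversely, a witness u ∈ R for s ∈ R* is 0 on the zero positions, so for an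
  -- allowed b it is the padded tuple itself.
  pad-complete : ∀ b s → T (star R s ∧ (not b ∨ not hasZeroPos)) → T (R (pad b s))
  pad-complete b s h with Equivalence.to T-∧ h
  ... | R*s , admissible with satisfied (any⁻ _ (allVecs k) R*s)
  ... | u , Ru∧proj with Equivalence.to T-∧ Ru∧proj
  ... | Ru , proj = subst (T ∘ R) (sym pad≡u) Ru
    where
    agree : ∀ {i} → i ∉ nonZeroPos R → lookup u i ≡ lookup (replicate k b) i
    agree {i} i∉ = begin
      lookup u i                  ≡⟨ zeroPos-vanishes (∉⇒zeroPos i∉) Ru ⟩
      false                       ≡⟨ sym (nandʳ admissible (any⁺ _ (lose (∈-allFin i) (∉⇒zeroPos i∉)))) ⟩
      b                           ≡⟨ sym (lookup-replicate i b) ⟩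
      lookup (replicate k b) i    ∎
    pad≡u : pad b s ≡ u
    pad≡u = begin
      fill (nonZeroPos R) s (replicate k b)
        ≡⟨ cong (λ v → fill (nonZeroPos R) v (replicate k b)) (sym (eqVec-sound proj)) ⟩
      fill (nonZeroPos R) (projV (nonZeroPos R) u) (replicate k b)
        ≡⟨ fill-projV (nonZeroPos R) u (replicate k b) agree ⟩
      u
        ∎

  pad-correct : ∀ b s → R (pad b s) ≡ star R s ∧ (not b ∨ not hasZeroPos)
  pad-correct b s = T-ext (pad-sound b s) (pad-complete b s)

  liftScope : ∀ {n} → Vec (Fin n) (starArity R) → Vec (Fin (suc n)) k
  liftScope sc = fill (nonZeroPos R) (mapᵛ suc sc) (replicate k zero)

  liftInstance : Instance (starArity R) → Instance k
  liftInstance I′ = record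
    { nvars       = suc (Instance.nvars I′)
    ; constraints = map liftScope (Instance.constraints I′)
    }

  lift-tuple : ∀ {n} b (σ : Vec Bool n) sc →
               mapᵛ (lookup (b ∷ σ)) (liftScope sc) ≡ pad b (mapᵛ (lookup σ) sc)
  lift-tuple b σ sc = begin
    mapᵛ (lookup (b ∷ σ)) (fill (nonZeroPos R) (mapᵛ suc sc) (replicate k zero))
      ≡⟨ map-fill (lookup (b ∷ σ)) (nonZeroPos R) (mapᵛ suc sc) (replicate k zero) ⟩
    fill (nonZeroPos R) (mapᵛ (lookup (b ∷ σ)) (mapᵛ suc sc)) (mapᵛ (lookup (b ∷ σ)) (replicate k zero))
      ≡⟨ cong₂ (fill (nonZeroPos R)) (sym (mapᵛ-∘ (lookup (b ∷ σ)) suc sc)) (map-replicate (lookup (b ∷ σ)) zero k) ⟩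
    pad b (mapᵛ (lookup σ) sc)
      ∎

  -- The fresh variable may be 1 iff R has no zero position or there are no constraints.
  freshFree : Instance (starArity R) → Bool
  freshFree I′ = not hasZeroPos ∨ null (Instance.constraints I′)

  lift-satisfies : ∀ I′ b σ →
    satisfies R (liftInstance I′) (b ∷ σ) ≡ satisfies (star R) I′ σ ∧ (not b ∨ freshFree I′)
  lift-satisfies I′ b σ = begin
    all (λ sc → R (mapᵛ (lookup (b ∷ σ)) sc)) (map liftScope cs)
      ≡⟨ all-map (λ sc → R (mapᵛ (lookup (b ∷ σ)) sc)) liftScope cs ⟩
    all (λ sc → R (mapᵛ (lookup (b ∷ σ)) (liftScope sc))) cs
      ≡⟨ all-cong (λ sc → trans (cong R (lift-tuple b σ sc)) (pad-correct b (mapᵛ (lookup σ) sc))) cs ⟩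
    all (λ sc → star R (mapᵛ (lookup σ) sc) ∧ (not b ∨ not hasZeroPos)) cs
      ≡⟨ all-∧-const (λ sc → star R (mapᵛ (lookup σ) sc)) (not b ∨ not hasZeroPos) cs ⟩
    satisfies (star R) I′ σ ∧ ((not b ∨ not hasZeroPos) ∨ null cs)
      ≡⟨ cong (satisfies (star R) I′ σ ∧_) (∨-assoc (not b) (not hasZeroPos) (null cs)) ⟩
    satisfies (star R) I′ σ ∧ (not b ∨ freshFree I′)
      ∎
    where
    cs : List (Vec (Fin (Instance.nvars I′)) (starArity R))
    cs = Instance.constraints I′

-- Counting Boolean vectors b ∷ σ for a predicate that factors as P′ σ ∧ (b == c):
-- exactly one value of the head contributes, so the count is that of P′.
count-extend : ∀ {n} (P : Vec Bool (suc n) → Bool) (P′ : Vec Bool n → Bool) (c : Bool) →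
               (∀ b σ → P (b ∷ σ) ≡ P′ σ ∧ eqBool b c) → count P (allVecs (suc n)) ≡ count P′ (allVecs n)
count-extend {n} P P′ c factor = begin
  count P (map (false ∷_) vs ++ map (true ∷_) vs)
    ≡⟨ count-++ P (map (false ∷_) vs) (map (true ∷_) vs) ⟩
  count P (map (false ∷_) vs) + count P (map (true ∷_) vs)
    ≡⟨ cong₂ _+_ (trans (count-map P (false ∷_) vs) (count-cong (factor false) vs))
                 (trans (count-map P (true ∷_) vs) (count-cong (factor true) vs)) ⟩
  count (λ σ → P′ σ ∧ not c) vs + count (λ σ → P′ σ ∧ c) vs
    ≡⟨ cong₂ _+_ (count-∧-const P′ (not c) vs) (count-∧-const P′ c vs) ⟩
  (if not c then count P′ vs else 0) + (if c then count P′ vs else 0)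
    ≡⟨ exactly-one c ⟩
  count P′ vs
    ∎
  where
  vs : List (Vec Bool n)
  vs = allVecs n
  exactly-one : ∀ c → (if not c then count P′ vs else 0) + (if c then count P′ vs else 0) ≡ count P′ vs
  exactly-one true  = refl
  exactly-one false = +-identityʳ (count P′ vs)

module FreshVariable {k k′ : ℕ} (R : BRel k) (R′ : BRel k′) (I′ : Instance k′)
                     (cs : List (Vec (Fin (suc (Instance.nvars I′))) k)) where

  n : ℕ
  n = Instance.nvars I′

  I : Instance k
  I = record { nvars = suc n ; constraints = cs }

  sat : Vec Bool (suc n) → Bool
  sat = satisfies R I

  sat′ : Vec Bool n → Bool
  sat′ = satisfies R′ I′

  max : Vec Bool (suc n) → Fin (suc n) → Bool
  max = maximalFor R I

  max′ : Vec Bool n → Fin n → Bool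
  max′ = maximalFor R′ I′

  -- The fresh variable does not interact with the others: it is free (c = true)
  -- or forced to 0 (c = false), and otherwise I is satisfied exactly when I′ is.
  Extends : Bool → Set
  Extends c = ∀ b σ → sat (b ∷ σ) ≡ sat′ σ ∧ (not b ∨ c)

  sat-allowed : ∀ {c} → Extends c → ∀ b → T (not b ∨ c) → ∀ σ → sat (b ∷ σ) ≡ sat′ σ
  sat-allowed H b ok σ = trans (H b σ) (trans (cong (sat′ σ ∧_) (Equivalence.to T-≡ ok)) (∧-identityʳ (sat′ σ)))

  old-maximal : ∀ {c} → Extends c → ∀ b → T (not b ∨ c) → ∀ σ v → max (b ∷ σ) (suc v) ≡ max′ σ v
  old-maximal H b ok σ v = cong (λ x → lookup σ v ∨ not x) (sat-allowed H b ok (σ [ v ]≔ true))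

  -- The common core of all three counts: satisfaction together with maximality at
  -- the fresh variable single out the value b = c, and any further condition Q
  -- that agrees with Q′ for allowed b is transferred.
  fiber : ∀ c → Extends c → (Q : Bool → Vec Bool n → Bool) (Q′ : Vec Bool n → Bool) →
          (∀ b → T (not b ∨ c) → ∀ σ → Q b σ ≡ Q′ σ) →
          ∀ b σ → sat (b ∷ σ) ∧ (max (b ∷ σ) zero ∧ Q b σ) ≡ (sat′ σ ∧ Q′ σ) ∧ eqBool b c
  fiber true H Q Q′ hQ true σ = begin
    sat (true ∷ σ) ∧ Q true σ   ≡⟨ cong₂ _∧_ (sat-allowed H true tt σ) (hQ true tt σ) ⟩
    sat′ σ ∧ Q′ σ               ≡⟨ sym (∧-identityʳ _) ⟩
    (sat′ σ ∧ Q′ σ) ∧ true      ∎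
  fiber true H Q Q′ hQ false σ = begin
    sat (false ∷ σ) ∧ (not (sat (true ∷ σ)) ∧ Q false σ)
      ≡⟨ cong₂ (λ x y → x ∧ (not y ∧ Q false σ)) (sat-allowed H false tt σ) (sat-allowed H true tt σ) ⟩
    sat′ σ ∧ (not (sat′ σ) ∧ Q false σ)   ≡⟨ sym (∧-assoc (sat′ σ) (not (sat′ σ)) (Q false σ)) ⟩
    (sat′ σ ∧ not (sat′ σ)) ∧ Q false σ   ≡⟨ cong (_∧ Q false σ) (∧-inverseʳ (sat′ σ)) ⟩
    false                                 ≡⟨ sym (∧-zeroʳ _) ⟩
    (sat′ σ ∧ Q′ σ) ∧ false               ∎
  fiber false H Q Q′ hQ true σ = begin
    sat (true ∷ σ) ∧ Q true σ   ≡⟨ cong (_∧ Q true σ) (trans (H true σ) (∧-zeroʳ (sat′ σ))) ⟩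
    false                       ≡⟨ sym (∧-zeroʳ _) ⟩
    (sat′ σ ∧ Q′ σ) ∧ false     ∎
  fiber false H Q Q′ hQ false σ = begin
    sat (false ∷ σ) ∧ (not (sat (true ∷ σ)) ∧ Q false σ)
      ≡⟨ cong₂ (λ x y → x ∧ (not y ∧ Q false σ)) (sat-allowed H false tt σ) (trans (H true σ) (∧-zeroʳ (sat′ σ))) ⟩
    sat′ σ ∧ Q false σ          ≡⟨ cong (sat′ σ ∧_) (hQ false tt σ) ⟩
    sat′ σ ∧ Q′ σ               ≡⟨ sym (∧-identityʳ _) ⟩
    (sat′ σ ∧ Q′ σ) ∧ true      ∎

  module _ (c : Bool) (H : Extends c) where

    locallyMaximal-fiber : ∀ b σ → locallyMaximal R I (b ∷ σ) ≡ locallyMaximal R′ I′ σ ∧ eqBool b c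
    locallyMaximal-fiber b σ = begin
      sat (b ∷ σ) ∧ all (max (b ∷ σ)) (allFin (suc n))
        ≡⟨ cong (sat (b ∷ σ) ∧_) (all-allFin-suc (max (b ∷ σ))) ⟩
      sat (b ∷ σ) ∧ (max (b ∷ σ) zero ∧ all (max (b ∷ σ) ∘ suc) (allFin n))
        ≡⟨ fiber c H (λ b σ → all (max (b ∷ σ) ∘ suc) (allFin n)) (λ σ → all (max′ σ) (allFin n))
                 (λ b ok σ → all-cong (old-maximal H b ok σ) (allFin n)) b σ ⟩
      locallyMaximal R′ I′ σ ∧ eqBool b c
        ∎

    N₀-fresh : ∀ r → N₀ R I (suc r) ≡ N₀ R′ I′ r
    N₀-fresh r = count-extend _ _ c λ b σ → begin
      locallyMaximal R I (b ∷ σ) ∧ not (lookup σ r)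
        ≡⟨ cong (_∧ not (lookup σ r)) (locallyMaximal-fiber b σ) ⟩
      (locallyMaximal R′ I′ σ ∧ eqBool b c) ∧ not (lookup σ r)
        ≡⟨ xy∙z≈xz∙y (locallyMaximal R′ I′ σ) (eqBool b c) (not (lookup σ r)) ⟩
      (locallyMaximal R′ I′ σ ∧ not (lookup σ r)) ∧ eqBool b c
        ∎

    N₁-fresh : ∀ r → N₁ R I (suc r) ≡ N₁ R′ I′ r
    N₁-fresh r = count-extend _ _ c λ b σ → begin
      locallyMaximal R I (b ∷ σ) ∧ lookup σ r
        ≡⟨ cong (_∧ lookup σ r) (locallyMaximal-fiber b σ) ⟩
      (locallyMaximal R′ I′ σ ∧ eqBool b c) ∧ lookup σ r
        ≡⟨ xy∙z≈xz∙y (locallyMaximal R′ I′ σ) (eqBool b c) (lookup σ r) ⟩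
      (locallyMaximal R′ I′ σ ∧ lookup σ r) ∧ eqBool b c
        ∎

    B-fresh : ∀ r → Bcount R I (suc r) ≡ Bcount R′ I′ r
    B-fresh r = count-extend _ _ c λ b σ → begin
      sat (b ∷ σ) ∧ all (maxAway (b ∷ σ)) (allFin (suc n)) ∧ not (max (b ∷ σ) (suc r))
        ≡⟨ cong (λ x → sat (b ∷ σ) ∧ x ∧ not (max (b ∷ σ) (suc r))) (all-allFin-suc (maxAway (b ∷ σ))) ⟩
      sat (b ∷ σ) ∧ (max (b ∷ σ) zero ∧ all (maxAway (b ∷ σ) ∘ suc) (allFin n)) ∧ not (max (b ∷ σ) (suc r))
        ≡⟨ cong (sat (b ∷ σ) ∧_) (∧-assoc (max (b ∷ σ) zero) _ (not (max (b ∷ σ) (suc r)))) ⟩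
      sat (b ∷ σ) ∧ (max (b ∷ σ) zero ∧ Q b σ)
        ≡⟨ fiber c H Q Q′ Q≡Q′ b σ ⟩
      (sat′ σ ∧ Q′ σ) ∧ eqBool b c
        ∎
      where
      maxAway : Vec Bool (suc n) → Fin (suc n) → Bool
      maxAway τ v = ⌊ v ≟ suc r ⌋ ∨ max τ v
      Q : Bool → Vec Bool n → Bool
      Q b σ = all (maxAway (b ∷ σ) ∘ suc) (allFin n) ∧ not (max (b ∷ σ) (suc r))
      Q′ : Vec Bool n → Bool
      Q′ σ = all (λ v → ⌊ v ≟ r ⌋ ∨ max′ σ v) (allFin n) ∧ not (max′ σ r)
      Q≡Q′ : ∀ b → T (not b ∨ c) → ∀ σ → Q b σ ≡ Q′ σ
      Q≡Q′ b ok σ = cong₂ _∧_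
        (all-cong (λ v → cong₂ _∨_ (⌊suc≟suc⌋ v r) (old-maximal H b ok σ v)) (allFin n))
        (cong not (old-maximal H b ok σ r))

fresh-gadget : ∀ {k k′} {R : BRel k} {R′ : BRel k′} (G : MaxGadget R′) →
               (cs : List (Vec (Fin (suc (Instance.nvars (MaxGadget.inst G)))) k)) (c : Bool) →
               FreshVariable.Extends R R′ (MaxGadget.inst G) cs c → MaxGadget R
fresh-gadget {R = R} {R′} G cs c H = record
  { inst = I
  ; root = suc root
  ; N₀≡1 = trans (N₀-fresh c H root) N₀≡1
  ; N₁≡1 = trans (N₁-fresh c H root) N₁≡1
  ; B≡0  = trans (B-fresh c H root) B≡0
  }
  where
  open MaxGadget G
  open FreshVariable R R′ inst cs

lemma16 : {k : ℕ} (R : BRel k) → MaxGadget (star R) → MaxGadget R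
lemma16 R G = fresh-gadget G (map liftScope (Instance.constraints I′)) (freshFree I′) (lift-satisfies I′)
  where
  open Padding R
  I′ : Instance (starArity R)
  I′ = MaxGadget.inst G
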